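{- Let $\mathcal{L}$ be the propositional language generated from a countably infinite set $\mathsf{Prop}$ of propositional variables by $\wedge$, $\vee$, $\neg$. For $\varphi\in\mathcal{L}$ let $\mathsf{Prop}(\varphi)$ be the set of variables occurring in $\varphi$. For any $\varphi,\psi\in\mathcal{L}$, the following are equivalent: (1) $\varphi\vdash_{\mathsf{C}}\psi$; (2) $\bigvee_{\delta\in sd(\mathsf{Prop}(\varphi)\cup\mathsf{Prop}(\psi))}(\delta\wedge\varphi)\vdash_{\mathsf{F}}\psi$.
   Context: Fundamental logic $\vdash_{\mathsf F}$ is the smallest binary relation $\vdash\subseteq\mathcal{L}\times\mathcal{L}$ such that for all $\varphi,\psi,\chi$: $\varphi\vdash\varphi$; $\varphi\wedge\psi\vdash\varphi$; $\varphi\wedge\psi\vdash\psi$; $\varphi\vdash\varphi\vee\psi$; $\varphi\vdash\psi\vee\varphi$; $\varphi\vdash\neg\neg\varphi$; $\varphi\wedge\neg\varphi\vdash\psi$; if $\varphi\vdash\psi$ and $\psi\vdash\chi$ then $\varphi\vdash\chi$; if $\varphi\vdash\psi$ and $\varphi\vdash\chi$ then $\varphi\vdash\psi\wedge\chi$; if $\varphi\vdash\chi$ and $\psi\vdash\chi$ then $\varphi\vee\psi\vdash\chi$; if $\varphi\vdash\psi$ then $\neg\psi\vdash\neg\varphi$. $\vdash_{\mathsf C}$ is classical propositional consequence ($\varphi\vdash_{\mathsf C}\psi$ iff every classical truth-value assignment making $\varphi$ true makes $\psi$ true). For a finite set $P=\{p_1,\dots,p_n\}$ of variables, $sd(P)$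 (the state descriptions over $P$) is the set of all conjunctions $\pm_1p_1\wedge\dots\wedge\pm_np_n$ where each $\pm_i$ is either $\neg$ or empty; the big disjunction in (2) is the (finite) disjunction over all these state descriptions. -}

module Defs where

open import Data.Nat using (ℕ)
open import Data.Nat.Properties using (_≟_)
open import Data.Bool using (Bool; true; false; _∧_; _∨_; not; T)
open import Data.List using (List; []; _∷_; _++_; deduplicate; filter)
open import Relation.Nullary.Decidable using (¬?)
open import Data.List.NonEmpty as L⁺ using (List⁺; _∷_; [_]; foldr₁)

Var : Set
Var = ℕ

data Form : Set where
  var  : Var → Form
  _∧'_ : Form → Form → Form
  _∨'_ : Form → Form → Form
  ¬'_  : Form → Form

infixr 6 _∧'_
infixr 5 _∨'_
infix 7 ¬'_

infix 3 _⊢F_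
data _⊢F_ : Form → Form → Set where
  refl⊢  : ∀ {φ} → φ ⊢F φ
  ∧e₁    : ∀ {φ ψ} → φ ∧' ψ ⊢F φ
  ∧e₂    : ∀ {φ ψ} → φ ∧' ψ ⊢F ψ
  ∨i₁    : ∀ {φ ψ} → φ ⊢F φ ∨' ψ
  ∨i₂    : ∀ {φ ψ} → φ ⊢F ψ ∨' φ
  dni    : ∀ {φ} → φ ⊢F ¬' ¬' φ
  efq    : ∀ {φ ψ} → φ ∧' ¬' φ ⊢F ψ
  trans⊢ : ∀ {φ ψ χ} → φ ⊢F ψ → ψ ⊢F χ → φ ⊢F χ
  ∧i     : ∀ {φ ψ χ} → φ ⊢F ψ → φ ⊢F χ → φ ⊢F ψ ∧' χ
  ∨e     : ∀ {φ ψ χ} → φ ⊢F χ → ψ ⊢F χ → φ ∨' ψ ⊢F χ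
  contra : ∀ {φ ψ} → φ ⊢F ψ → ¬' ψ ⊢F ¬' φ

Valuation : Set
Valuation = Var → Bool

⟦_⟧ : Form → Valuation → Bool
⟦ var p ⟧ v = v p
⟦ φ ∧' ψ ⟧ v = ⟦ φ ⟧ v ∧ ⟦ ψ ⟧ v
⟦ φ ∨' ψ ⟧ v = ⟦ φ ⟧ v ∨ ⟦ ψ ⟧ v
⟦ ¬' φ ⟧ v = not (⟦ φ ⟧ v)

infix 3 _⊢C_
_⊢C_ : Form → Form → Set
φ ⊢C ψ = (v : Valuation) → T (⟦ φ ⟧ v) → T (⟦ ψ ⟧ v)

-- Prop(φ), as a nonempty list of variables (possibly with repetitions).
vars⁺ : Form → List⁺ Var
vars⁺ (var p) = [ p ]
vars⁺ (φ ∧' ψ) = vars⁺ φ L⁺.⁺++⁺ vars⁺ ψ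
vars⁺ (φ ∨' ψ) = vars⁺ φ L⁺.⁺++⁺ vars⁺ ψ
vars⁺ (¬' φ) = vars⁺ φ

dedup⁺ : List⁺ Var → List⁺ Var
dedup⁺ (p ∷ ps) = p ∷ deduplicate _≟_ (filter (λ q → ¬? (p ≟ q)) ps)

varsUnion : Form → Form → List⁺ Var
varsUnion φ ψ = dedup⁺ (vars⁺ φ L⁺.⁺++⁺ vars⁺ ψ)

-- State descriptions over a nonempty duplicate-free list [p₁,…,pₙ]:
-- all conjunctions ±p₁ ∧ (±p₂ ∧ … ∧ ±pₙ).
sd' : Var → List Var → List⁺ Form
sd' p [] = var p ∷ (¬' var p) ∷ []
sd' p (q ∷ qs) =
  L⁺.map (λ δ → var p ∧' δ) rest L⁺.⁺++⁺ L⁺.map (λ δ → ¬' var p ∧' δ) rest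
  where rest = sd' q qs

sd : List⁺ Var → List⁺ Form
sd (p ∷ ps) = sd' p ps

⋁ : List⁺ Form → Form
⋁ = foldr₁ _∨'_

{-# OPTIONS --safe #-}
-- (2) ⇒ (1) is soundness of ⊢F for two-valued semantics, since every valuation
-- satisfies one of the state descriptions.  For (1) ⇒ (2), a state description δ
-- proves, for some valuation v, the literal v assigns to each of its variables; by
-- induction on χ it then proves χ or ¬χ according to the value of χ under v, using
-- only ¬¬-introduction, contraposition and ¬χ₁ ∧ ¬χ₂ ⊢ ¬(χ₁ ∨ χ₂).  Hence δ ∧ φ
-- proves φ ∧ ¬φ when v falsifies φ, and δ proves ψ when v satisfies φ.
module Submission where

open import Defs
open import Function.Base using (_∘_)
open import Function.Bundles using (_⇔_; mk⇔; Equivalence)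
open import Data.List.NonEmpty using (List⁺; _∷_; toList; map; _⁺++⁺_)
open import Data.List using (List; []; _∷_)
open import Data.Bool using (Bool; true; false; _∧_; _∨_; not; T; if_then_else_)
open import Data.Bool.Properties using (T-≡; T-not-≡; T-∧; T-∨; not-involutive; ∧-inverseʳ)
open import Data.Empty using (⊥-elim)
open import Data.Product using (∃; _,_; proj₁; proj₂)
open import Data.Sum using (inj₁; inj₂; [_,_])
open import Data.Nat.Properties using (_≟_)
open import Relation.Nullary using (yes; no; does)
open import Relation.Nullary.Decidable using (¬?; dec-true; dec-false)
open import Relation.Binary.PropositionalEquality using (_≡_; refl; sym; subst)
open import Data.List.Relation.Unary.All as All using (All; []; _∷_)
open import Data.List.Relation.Unary.Any using (here; there)
import Data.List.Relation.Unary.All.Properties as All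
open import Data.List.Relation.Binary.Subset.Propositional using (_⊆_)
open import Data.List.Relation.Binary.Subset.Propositional.Properties using (xs⊆xs++ys; xs⊆ys++xs)
open import Data.List.Membership.Propositional using (_∈_)
open import Data.List.Membership.Propositional.Properties
  using (∈-map⁺; ∈-++⁺ˡ; ∈-++⁺ʳ; ∈-filter⁺; ∈-deduplicate⁺)

open Equivalence using (to; from)

contraposeᵀ : ∀ {a b} → (T a → T b) → T (not b) → T (not a)
contraposeᵀ {false}         _ _  = _
contraposeᵀ {true} {true}   _ ()
contraposeᵀ {true} {false}  f _  = f _

soundness : ∀ {φ ψ} → φ ⊢F ψ → φ ⊢C ψ
soundness refl⊢        v = λ t → t
soundness ∧e₁          v = proj₁ ∘ to T-∧
soundness ∧e₂          v = proj₂ ∘ to T-∧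
soundness ∨i₁          v = from T-∨ ∘ inj₁
soundness ∨i₂          v = from T-∨ ∘ inj₂
soundness (dni {φ})    v = subst T (sym (not-involutive (⟦ φ ⟧ v)))
soundness (efq {φ})    v = ⊥-elim ∘ subst T (∧-inverseʳ (⟦ φ ⟧ v))
soundness (trans⊢ d e) v = soundness e v ∘ soundness d v
soundness (∧i d e)     v = λ t → from T-∧ (soundness d v t , soundness e v t)
soundness (∨e d e)     v = [ soundness d v , soundness e v ] ∘ to T-∨
soundness (contra d)   v = contraposeᵀ (soundness d v)

⋁-intro : ∀ {χ} (xs : List⁺ Form) → χ ∈ toList xs → χ ⊢F ⋁ xs
⋁-intro (x ∷ [])     (here refl) = refl⊢
⋁-intro (x ∷ y ∷ ys) (here refl) = ∨i₁
⋁-intro (x ∷ y ∷ ys) (there χ∈) = trans⊢ (⋁-intro (y ∷ ys) χ∈) ∨i₂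

⋁-elim : ∀ {ψ} (xs : List⁺ Form) → All (_⊢F ψ) (toList xs) → ⋁ xs ⊢F ψ
⋁-elim (x ∷ [])     (d ∷ [])  = d
⋁-elim (x ∷ y ∷ ys) (d ∷ ds) = ∨e d (⋁-elim (y ∷ ys) ds)

signed : Bool → Form → Form
signed true  χ = χ
signed false χ = ¬' χ

T-⟦signed⟧ : ∀ b χ v → ⟦ χ ⟧ v ≡ b → T (⟦ signed b χ ⟧ v)
T-⟦signed⟧ true  χ v = from T-≡
T-⟦signed⟧ false χ v = from T-not-≡

-- χ₁ ⊢ ¬¬χ₁ ⊢ ¬(¬χ₁ ∧ ¬χ₂), and likewise for χ₂; contrapose the disjunction.
¬∧¬⊢F¬∨ : ∀ {χ₁ χ₂} → ¬' χ₁ ∧' ¬' χ₂ ⊢F ¬' (χ₁ ∨' χ₂)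
¬∧¬⊢F¬∨ = trans⊢ dni (contra (∨e (trans⊢ dni (contra ∧e₁)) (trans⊢ dni (contra ∧e₂))))

signed-∧ : ∀ b c {δ χ₁ χ₂} →
  δ ⊢F signed b χ₁ → δ ⊢F signed c χ₂ → δ ⊢F signed (b ∧ c) (χ₁ ∧' χ₂)
signed-∧ true  true  d e = ∧i d e
signed-∧ true  false d e = trans⊢ e (contra ∧e₂)
signed-∧ false c     d e = trans⊢ d (contra ∧e₁)

signed-∨ : ∀ b c {δ χ₁ χ₂} →
  δ ⊢F signed b χ₁ → δ ⊢F signed c χ₂ → δ ⊢F signed (b ∨ c) (χ₁ ∨' χ₂)
signed-∨ true  c     d e = trans⊢ d ∨i₁
signed-∨ false true  d e = trans⊢ e ∨i₂
signed-∨ false false d e = trans⊢ (∧i d e) ¬∧¬⊢F¬∨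

signed-¬ : ∀ b {δ χ} → δ ⊢F signed b χ → δ ⊢F signed (not b) (¬' χ)
signed-¬ true  d = trans⊢ d dni
signed-¬ false d = d

Fixes : Form → Valuation → List Var → Set
Fixes δ v rs = All (λ r → δ ⊢F signed (v r) (var r)) rs

fixes⇒signed-⟦⟧ : ∀ χ {δ v} → Fixes δ v (toList (vars⁺ χ)) → δ ⊢F signed (⟦ χ ⟧ v) χ
fixes⇒signed-⟦⟧ (var p)    (d ∷ []) = d
fixes⇒signed-⟦⟧ (χ₁ ∧' χ₂) fs =
  signed-∧ _ _ (fixes⇒signed-⟦⟧ χ₁ (All.++⁻ˡ (toList (vars⁺ χ₁)) fs))
               (fixes⇒signed-⟦⟧ χ₂ (All.++⁻ʳ (toList (vars⁺ χ₁)) fs))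
fixes⇒signed-⟦⟧ (χ₁ ∨' χ₂) fs =
  signed-∨ _ _ (fixes⇒signed-⟦⟧ χ₁ (All.++⁻ˡ (toList (vars⁺ χ₁)) fs))
               (fixes⇒signed-⟦⟧ χ₂ (All.++⁻ʳ (toList (vars⁺ χ₁)) fs))
fixes⇒signed-⟦⟧ (¬' χ)     fs = signed-¬ _ (fixes⇒signed-⟦⟧ χ fs)

signed-⊢F : ∀ b c {δ φ ψ} →
  (T b → T c) → δ ⊢F signed b φ → δ ⊢F signed c ψ → δ ∧' φ ⊢F ψ
signed-⊢F true  true  _   _  δ⊢ψ  = trans⊢ ∧e₁ δ⊢ψ
signed-⊢F true  false b⇒c _  _    = ⊥-elim (b⇒c _)
signed-⊢F false c     _   δ⊢¬φ _  = trans⊢ (∧i ∧e₂ (trans⊢ ∧e₁ δ⊢¬φ)) efq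

fixes⇒∧⊢F : ∀ {φ ψ δ v rs} → φ ⊢C ψ →
  toList (vars⁺ φ) ⊆ rs → toList (vars⁺ ψ) ⊆ rs → Fixes δ v rs → δ ∧' φ ⊢F ψ
fixes⇒∧⊢F {φ} {ψ} {v = v} φ⊢ψ φ⊆rs ψ⊆rs fs =
  signed-⊢F (⟦ φ ⟧ v) (⟦ ψ ⟧ v) (φ⊢ψ v)
    (fixes⇒signed-⟦⟧ φ (All.anti-mono φ⊆rs fs))
    (fixes⇒signed-⟦⟧ ψ (All.anti-mono ψ⊆rs fs))

updated : Valuation → Var → Bool → Valuation
updated v p b r = if does (r ≟ p) then b else v r

fixes-updated : ∀ {δ δ′ v p b rs} →
  δ ⊢F signed b (var p) → δ ⊢F δ′ → Fixes δ′ v rs → Fixes δ (updated v p b) (p ∷ rs)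
fixes-updated {δ} {δ′} {v} {p} {b} δ⊢p δ⊢δ′ fs = fixes-p ∷ All.map fixes-r fs
  where
  fixes-p : δ ⊢F signed (updated v p b p) (var p)
  fixes-p rewrite dec-true (p ≟ p) refl = δ⊢p
  fixes-r : ∀ {r} → δ′ ⊢F signed (v r) (var r) → δ ⊢F signed (updated v p b r) (var r)
  fixes-r {r} δ′⊢r with r ≟ p
  ... | yes refl = fixes-p
  ... | no r≢p rewrite dec-false (r ≟ p) r≢p = trans⊢ δ⊢δ′ δ′⊢r

sd-fixes : ∀ p qs → All (λ δ → ∃ λ v → Fixes δ v (p ∷ qs)) (toList (sd (p ∷ qs)))
sd-fixes p [] = ((λ _ → true) , refl⊢ ∷ []) ∷ ((λ _ → false) , refl⊢ ∷ []) ∷ []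
sd-fixes p (q ∷ qs) =
  All.++⁺ (All.map⁺ (All.map (extend true) (sd-fixes q qs)))
          (All.map⁺ (All.map (extend false) (sd-fixes q qs)))
  where
  extend : ∀ b {δ} → ∃ (λ v → Fixes δ v (q ∷ qs)) →
    ∃ λ v → Fixes (signed b (var p) ∧' δ) v (p ∷ q ∷ qs)
  extend b (v , fs) = updated v p b , fixes-updated ∧e₁ ∧e₂ fs

description : Valuation → Var → List Var → Form
description v p []       = signed (v p) (var p)
description v p (q ∷ qs) = signed (v p) (var p) ∧' description v q qs

description∈sd : ∀ v p qs → description v p qs ∈ toList (sd (p ∷ qs))
description∈sd v p [] = literal∈ (v p)
  where
  literal∈ : ∀ b → signed b (var p) ∈ toList (sd (p ∷ []))
  literal∈ true  = here refl
  literal∈ false = there (here refl)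
description∈sd v p (q ∷ qs) = literal∧∈ (v p) (description∈sd v q qs)
  where
  literal∧∈ : ∀ b {δ} → δ ∈ toList (sd (q ∷ qs)) →
    signed b (var p) ∧' δ ∈ toList (sd (p ∷ q ∷ qs))
  literal∧∈ true  δ∈ = ∈-++⁺ˡ (∈-map⁺ _ δ∈)
  literal∧∈ false δ∈ = ∈-++⁺ʳ (toList (map (var p ∧'_) (sd (q ∷ qs)))) (∈-map⁺ _ δ∈)

T-⟦description⟧ : ∀ v p qs → T (⟦ description v p qs ⟧ v)
T-⟦description⟧ v p []       = T-⟦signed⟧ (v p) (var p) v refl
T-⟦description⟧ v p (q ∷ qs) =
  from T-∧ (T-⟦signed⟧ (v p) (var p) v refl , T-⟦description⟧ v q qs)

⋁sd⊢F⇒⊢C : ∀ {φ ψ} U → ⋁ (map (_∧' φ) (sd U)) ⊢F ψ → φ ⊢C ψ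
⋁sd⊢F⇒⊢C {φ} (p ∷ ps) ⋁⊢ψ v φ-true =
  soundness (trans⊢ (⋁-intro (map (_∧' φ) (sd (p ∷ ps)))
                             (∈-map⁺ _ (description∈sd v p ps)))
                    ⋁⊢ψ) v
    (from T-∧ (T-⟦description⟧ v p ps , φ-true))

⊢C⇒⋁sd⊢F : ∀ {φ ψ} U → toList (vars⁺ φ) ⊆ toList U → toList (vars⁺ ψ) ⊆ toList U →
  φ ⊢C ψ → ⋁ (map (_∧' φ) (sd U)) ⊢F ψ
⊢C⇒⋁sd⊢F {φ} (p ∷ ps) φ⊆U ψ⊆U φ⊢ψ =
  ⋁-elim (map (_∧' φ) (sd (p ∷ ps)))
    (All.map⁺ (All.map (λ (_ , fs) → fixes⇒∧⊢F φ⊢ψ φ⊆U ψ⊆U fs) (sd-fixes p ps)))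

⊆-dedup⁺ : ∀ xs → toList xs ⊆ toList (dedup⁺ xs)
⊆-dedup⁺ (p ∷ ps) (here r≡p) = here r≡p
⊆-dedup⁺ (p ∷ ps) {r} (there r∈ps) with r ≟ p
... | yes r≡p = here r≡p
... | no  r≢p = there (∈-deduplicate⁺ _≟_ (∈-filter⁺ (λ q → ¬? (p ≟ q)) r∈ps (r≢p ∘ sym)))

vars⊆varsUnionˡ : ∀ φ ψ → toList (vars⁺ φ) ⊆ toList (varsUnion φ ψ)
vars⊆varsUnionˡ φ ψ =
  ⊆-dedup⁺ (vars⁺ φ ⁺++⁺ vars⁺ ψ) ∘ xs⊆xs++ys (toList (vars⁺ φ)) (toList (vars⁺ ψ))

vars⊆varsUnionʳ : ∀ φ ψ → toList (vars⁺ ψ) ⊆ toList (varsUnion φ ψ)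
vars⊆varsUnionʳ φ ψ =
  ⊆-dedup⁺ (vars⁺ φ ⁺++⁺ vars⁺ ψ) ∘ xs⊆ys++xs (toList (vars⁺ ψ)) (toList (vars⁺ φ))

proposition2p4 : (φ ψ : Form) →
    (φ ⊢C ψ) ⇔ (⋁ (map (λ δ → δ ∧' φ) (sd (varsUnion φ ψ))) ⊢F ψ)
proposition2p4 φ ψ = mk⇔
  (⊢C⇒⋁sd⊢F U (vars⊆varsUnionˡ φ ψ) (vars⊆varsUnionʳ φ ψ))
  (⋁sd⊢F⇒⊢C U)
  where U = varsUnion φ ψ
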